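{- Let $G$ be a graph and $(U,V)$ an $\epsilon$-regular pair of disjoint vertex subsets with $|U|,|V|\geq n$ and $d(U,V)=d$. Suppose $n\geq\epsilon^{ -2}$ and $d>\epsilon+\sqrt{\epsilon}$. Then for any vertex $v\in V$ with at least $(d-\epsilon)|U|$ neighbors in $U$ and any positive integer $l\leq 2(1-\sqrt{\epsilon})n-1$, there are at least $(d-\epsilon-\sqrt{\epsilon})^l\prod_{i=1}^l(n-\lfloor i/2\rfloor)$ paths of length $l$ in $G[U,V]$ starting from $v$.
   Context: $d(X,Y)=e(X,Y)/(|X||Y|)$ where $e(X,Y)$ is the number of edges between $X$ and $Y$. A pair $(X,Y)$ is $\epsilon$-regular if for all $U'\subset X$, $V'\subset Y$ with $|U'|\geq\epsilon|X|$, $|V'|\geq\epsilon|Y|$, $|d(U',V')-d(X,Y)|\leq\epsilon$. $G[U,V]$ is the bipartite graph with parts $U,V$ whose edges are the edges of $G$ between $U$ and $V$. The length of a path is its number of edges. -}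

module Defs where

open import Data.Nat as ℕ using (ℕ; zero; suc; _∸_)
open import Data.Nat.DivMod using () renaming (_/_ to _div_)
open import Data.Integer using (+_)
open import Data.Rational as ℚ using (ℚ; 0ℚ; 1ℚ; _+_; _*_; _-_; _<_; _≤_; ∣_∣)
open import Data.Bool using (Bool; true; false; if_then_else_; _∧_)
open import Data.Fin using (Fin; zero; suc; inject₁)
open import Data.Vec using (Vec; lookup; head)
open import Data.Product using (Σ; ∃; _×_; _,_)
open import Data.Sum using (_⊎_)
open import Relation.Nullary using (¬_)
open import Relation.Binary.PropositionalEquality using (_≡_)

-- Real numbers as Dedekind cuts over ℚ (the library has no reals).
-- Lo q means q < x, Up q means x < q.

record ℝ : Set₁ where
  field
    Lo Up      : ℚ → Set
    inhabitedL : ∃ Lo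
    inhabitedU : ∃ Up
    roundedL→  : ∀ q → Lo q → ∃ λ r → q < r × Lo r
    roundedL←  : ∀ q r → q < r → Lo r → Lo q
    roundedU→  : ∀ q → Up q → ∃ λ r → r < q × Up r
    roundedU←  : ∀ q r → r < q → Up r → Up q
    disjoint   : ∀ q → ¬ (Lo q × Up q)
    located    : ∀ q r → q < r → Lo q ⊎ Up r
open ℝ public

_ℚ≤ℝ_ : ℚ → ℝ → Set
c ℚ≤ℝ x = ∀ q → Up x q → c ≤ q
_ℝ≤ℚ_ : ℝ → ℚ → Set
x ℝ≤ℚ c = ∀ q → Lo x q → q ≤ c

ℕ→ℚ : ℕ → ℚ
ℕ→ℚ m = + m ℚ./ 1

RealTimesLe : ℝ → ℕ → ℕ → Set
RealTimesLe x m k = ∀ q → Lo x q → q * ℕ→ℚ m ≤ ℕ→ℚ k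

-- For ε > 0: q < √ε  and  √ε < q
SqrtLower : ℝ → ℚ → Set
SqrtLower ε q = q < 0ℚ ⊎ (0ℚ ≤ q × Lo ε (q * q))

SqrtUpper : ℝ → ℚ → Set
SqrtUpper ε q = 0ℚ < q × Up ε (q * q)

record Graph (N : ℕ) : Set where
  field
    adj     : Fin N → Fin N → Bool
    adj-sym : ∀ x y → adj x y ≡ adj y x
    adj-irr : ∀ x → adj x x ≡ false
open Graph public

VSet : ℕ → Set
VSet N = Vec Bool N

sumFin : ∀ {N} → (Fin N → ℕ) → ℕ
sumFin {zero}  f = 0
sumFin {suc N} f = f zero ℕ.+ sumFin (λ i → f (suc i))

size : ∀ {N} → VSet N → ℕ
size X = sumFin (λ x → if lookup X x then 1 else 0)

_⊆ᵥ_ : ∀ {N} → VSet N → VSet N → Set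
X ⊆ᵥ Y = ∀ x → lookup X x ≡ true → lookup Y x ≡ true

Disjoint : ∀ {N} → VSet N → VSet N → Set
Disjoint X Y = ∀ x → lookup X x ≡ true → lookup Y x ≡ false

edges : ∀ {N} → Graph N → VSet N → VSet N → ℕ
edges G X Y = sumFin λ x → sumFin λ y →
  if lookup X x ∧ lookup Y y ∧ adj G x y then 1 else 0

-- d(X,Y) = e(X,Y)/(|X||Y|)  (set to 0 when a part is empty)
density : ∀ {N} → Graph N → VSet N → VSet N → ℚ
density G X Y with size X ℕ.* size Y
... | zero  = 0ℚ
... | suc k = + edges G X Y ℚ./ suc k

Regular : ∀ {N} → Graph N → ℝ → VSet N → VSet N → Set
Regular G ε X Y = ∀ (X' Y' : VSet _) → X' ⊆ᵥ X → Y' ⊆ᵥ Y →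
  RealTimesLe ε (size X) (size X') → RealTimesLe ε (size Y) (size Y') →
  ∣ density G X' Y' - density G X Y ∣ ℚ≤ℝ ε

degIn : ∀ {N} → Graph N → VSet N → Fin N → ℕ
degIn G U v = sumFin λ u → if lookup U u ∧ adj G v u then 1 else 0

EdgeUV : ∀ {N} → Graph N → VSet N → VSet N → Fin N → Fin N → Set
EdgeUV G U V x y = adj G x y ≡ true ×
  ((lookup U x ≡ true × lookup V y ≡ true) ⊎ (lookup V x ≡ true × lookup U y ≡ true))

IsPathFrom : ∀ {N} → Graph N → VSet N → VSet N → Fin N → (l : ℕ) → Vec (Fin N) (suc l) → Set
IsPathFrom G U V v l w =
  head w ≡ v ×
  (∀ i j → lookup w i ≡ lookup w j → i ≡ j) ×
  (∀ (i : Fin l) → EdgeUV G U V (lookup w (inject₁ i)) (lookup w (suc i)))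

-- "at least r paths": an injective family of K ≥ r such paths
AtLeastPaths : ∀ {N} → Graph N → VSet N → VSet N → Fin N → ℕ → ℚ → Set
AtLeastPaths {N} G U V v l r = Σ ℕ λ K → r ≤ ℕ→ℚ K ×
  Σ (Fin K → Vec (Fin N) (suc l)) λ f →
    (∀ i j → f i ≡ f j → i ≡ j) × (∀ i → IsPathFrom G U V v l (f i))

_^ℚ_ : ℚ → ℕ → ℚ
q ^ℚ zero  = 1ℚ
q ^ℚ suc k = q * (q ^ℚ k)

prodFl : ℕ → ℕ → ℕ
prodFl n zero    = 1
prodFl n (suc i) = prodFl n i ℕ.* (n ∸ (suc i div 2))

-- The paths are grown greedily from v, alternating between the sides, one vertex at a time. A path is
-- kept only while its endpoint is typical: it has at least (d - a)|T ∖ p| neighbours among the unused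
-- vertices T ∖ p of the side it moves to next. Because l ≤ 2(1 - √ε)n - 1, the unused part of each side
-- remains ε-large, so regularity allows at most b|T ∖ p| atypical vertices in T ∖ p. Every path of
-- length j therefore has at least (d - a - b)(n - ⌊(j+1)/2⌋) admissible extensions, and the bound is
-- the product of these numbers over j < l. Since ε is a Dedekind cut, ε and √ε only enter through
-- rationals a > ε and b > √ε.

module Submission where

module PathsInRegularPairs where

  open import Defs
  open import Data.Bool using (Bool; true; false; if_then_else_; _∧_; _∨_; not)
  import Data.Bool.Properties as BoolP
  open import Data.Empty using (⊥-elim)
  open import Data.Fin as Fin using (Fin; zero; suc; inject₁; fromℕ)
  import Data.Fin.Properties as FinP
  import Data.Integer as ℤ
  import Data.Integer.Properties as ℤP
  open import Data.List as List using (List; []; _∷_; _++_; length)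
  import Data.List.Properties as ListP
  open import Data.List.Membership.Propositional using (_∈_)
  open import Data.List.Membership.Propositional.Properties using (∈-map⁻; ∈-++⁻; ∈-lookup)
  open import Data.List.Relation.Unary.All as All using (All; []; _∷_)
  open import Data.List.Relation.Unary.AllPairs using ([]; _∷_)
  open import Data.List.Relation.Unary.Any using (here; there)
  open import Data.List.Relation.Unary.Unique.Propositional using (Unique)
  import Data.List.Relation.Unary.Unique.Propositional.Properties as UniqueP
  open import Data.Nat as ℕ using (ℕ; zero; suc; z≤n; s≤s)
  import Data.Nat.DivMod as DM
  import Data.Nat.Properties as ℕP
  open import Data.Product using (∃; _×_; _,_; proj₁; proj₂)
  open import Data.Rational as ℚ using (ℚ; 0ℚ; 1ℚ; _+_; _*_; _-_; -_; _<_; _≤_)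
  import Data.Rational.Properties as ℚP
  open import Data.Rational.Solver using (module +-*-Solver)
  import Data.Rational.Unnormalised as ℚᵘ
  import Data.Rational.Unnormalised.Properties as ℚᵘP
  open import Data.Sum using (_⊎_; inj₁; inj₂; [_,_]′)
  open import Data.Vec as Vec using (Vec; []; _∷_; _∷ʳ_; lookup)
  import Data.Vec.Properties as VecP
  open import Function using (_∘_; case_of_)
  open import Relation.Binary using (tri<; tri≈; tri>)
  open import Relation.Binary.PropositionalEquality hiding ([_])
  open import Relation.Nullary using (¬_; contradiction; Dec; yes; no; does)
  open import Relation.Nullary.Decidable using (dec-true)
  open import Algebra.Properties.CommutativeMonoid.Sum ℕP.+-0-commutativeMonoid using (sum; ∑-distrib-+; ∑-comm; sum-replicate-zero)
  open +-*-Solver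

  <⇒≱ : ∀ {p q} → p < q → ¬ q ≤ p
  <⇒≱ p<q q≤p = ℚP.<-irrefl refl (ℚP.<-≤-trans p<q q≤p)

  ≤-via-difference : ∀ {p q e} → q - p ≡ e → 0ℚ ≤ e → p ≤ q
  ≤-via-difference {p} {q} q-p≡e 0≤e = subst₂ _≤_ (ℚP.+-identityˡ p) (solve 2 (λ p q → (q :- p) :+ p := q) refl p q)
    (ℚP.+-monoˡ-≤ p (subst (0ℚ ≤_) (sym q-p≡e) 0≤e))

  <-via-difference : ∀ {p q e} → q - p ≡ e → 0ℚ < e → p < q
  <-via-difference {p} {q} q-p≡e 0<e = subst₂ _<_ (ℚP.+-identityˡ p) (solve 2 (λ p q → (q :- p) :+ p := q) refl p q)
    (ℚP.+-monoˡ-< p (subst (0ℚ <_) (sym q-p≡e) 0<e))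

  p≤q⇒0≤q-p : ∀ {p q} → p ≤ q → 0ℚ ≤ q - p
  p≤q⇒0≤q-p {p} {q} p≤q = subst (_≤ q - p) (ℚP.+-inverseʳ p) (ℚP.+-monoˡ-≤ (- p) p≤q)

  p<q⇒0<q-p : ∀ {p q} → p < q → 0ℚ < q - p
  p<q⇒0<q-p {p} {q} p<q = subst (_< q - p) (ℚP.+-inverseʳ p) (ℚP.+-monoˡ-< (- p) p<q)

  0≤p*q : ∀ {p q} → 0ℚ ≤ p → 0ℚ ≤ q → 0ℚ ≤ p * q
  0≤p*q {p} {q} 0≤p 0≤q = subst (_≤ p * q) (ℚP.*-zeroˡ q) (ℚP.*-monoʳ-≤-nonNeg q {{ℚ.nonNegative 0≤q}} 0≤p)

  0<p*q : ∀ {p q} → 0ℚ < p → 0ℚ < q → 0ℚ < p * q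
  0<p*q {p} {q} 0<p 0<q = subst (_< p * q) (ℚP.*-zeroˡ q) (ℚP.*-monoˡ-<-pos q {{ℚ.positive 0<q}} 0<p)

  ∣p-q∣≤r⇒q-r≤p : ∀ {p q r} → 0ℚ ≤ r → ℚ.∣ p - q ∣ ≤ r → q - r ≤ p
  ∣p-q∣≤r⇒q-r≤p {p} {q} {r} 0≤r ∣p-q∣≤r with ℚP.∣p∣≡p∨∣p∣≡-p (p - q)
  ... | inj₁ ∣p-q∣≡p-q  = ≤-via-difference (solve 3 (λ p q r → p :- (q :- r) := (p :- q) :+ r) refl p q r)
                            (ℚP.+-mono-≤ (subst (0ℚ ≤_) ∣p-q∣≡p-q (ℚP.0≤∣p∣ (p - q))) 0≤r)
  ... | inj₂ ∣p-q∣≡-p-q = ≤-via-difference (solve 3 (λ p q r → p :- (q :- r) := r :- (:- (p :- q))) refl p q r)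
                            (p≤q⇒0≤q-p (subst (_≤ r) ∣p-q∣≡-p-q ∣p-q∣≤r))

  0≤p+p⇒0≤p : ∀ {p} → 0ℚ ≤ p + p → 0ℚ ≤ p
  0≤p+p⇒0≤p {p} 0≤p+p with ℚP.≤-total 0ℚ p
  ... | inj₁ 0≤p = 0≤p
  ... | inj₂ p≤0 = ℚP.≤-trans 0≤p+p (subst (p + p ≤_) (ℚP.+-identityʳ p) (ℚP.+-monoʳ-≤ p p≤0))

  -- An opaque copy of ℕ→ℚ: unfolding ℕ→ℚ (suc k) starts a gcd normalisation that the typechecker
  -- would otherwise attempt whenever it compares two such terms.
  opaque
    toℚ : ℕ → ℚ
    toℚ = ℕ→ℚ

    toℚ≡ℕ→ℚ : ∀ m → toℚ m ≡ ℕ→ℚ m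
    toℚ≡ℕ→ℚ m = refl

    toℚ-zero : toℚ 0 ≡ 0ℚ
    toℚ-zero = refl

    RealTimesLe⁺ : ∀ ε s m → (∀ p → Lo ε p → p * toℚ s ≤ toℚ m) → RealTimesLe ε s m
    RealTimesLe⁺ ε s m ps≤m = ps≤m

    toℚ-suc : ∀ m → toℚ (suc m) ≡ 1ℚ + toℚ m
    toℚ-suc m = ℚP.toℚᵘ-injective (begin
      ℚ.toℚᵘ (toℚ (suc m))         ≈⟨ embed (suc m) ⟩
      ℚᵘ.mkℚᵘ (ℤ.+ suc m) 0          ≈⟨ ℚᵘ.*≡* (cong (λ z → (ℤ.+ 1 ℤ.+ z) ℤ.* ℤ.+ 1) (sym (ℤP.*-identityʳ (ℤ.+ m)))) ⟩
      ℚᵘ.1ℚᵘ ℚᵘ.+ ℚᵘ.mkℚᵘ (ℤ.+ m) 0  ≈⟨ ℚᵘP.+-congʳ ℚᵘ.1ℚᵘ (ℚᵘP.≃-sym (embed m)) ⟩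
      ℚᵘ.1ℚᵘ ℚᵘ.+ ℚ.toℚᵘ (toℚ m)   ≈⟨ ℚᵘP.≃-sym (ℚP.toℚᵘ-homo-+ 1ℚ (toℚ m)) ⟩
      ℚ.toℚᵘ (1ℚ + toℚ m)          ∎)
      where
      open import Relation.Binary.Reasoning.Setoid ℚᵘP.≃-setoid
      embed : ∀ k → ℚ.toℚᵘ (toℚ k) ℚᵘ.≃ ℚᵘ.mkℚᵘ (ℤ.+ k) 0
      embed k = ℚP.toℚᵘ-fromℚᵘ (ℚᵘ.mkℚᵘ (ℤ.+ k) 0)

    0≤toℚ : ∀ m → 0ℚ ≤ toℚ m
    0≤toℚ m = ℚP.nonNegative⁻¹ (toℚ m) {{ℚP.normalize-nonNeg m 1}}

    m/n*n≡m : ∀ m n → (ℤ.+ m ℚ./ suc n) * toℚ (suc n) ≡ toℚ m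
    m/n*n≡m m n = ℚP.toℚᵘ-injective (begin
      ℚ.toℚᵘ ((ℤ.+ m ℚ./ suc n) * toℚ (suc n))                     ≈⟨ ℚP.toℚᵘ-homo-* (ℤ.+ m ℚ./ suc n) (toℚ (suc n)) ⟩
      ℚ.toℚᵘ (ℤ.+ m ℚ./ suc n) ℚᵘ.* ℚ.toℚᵘ (toℚ (suc n))          ≈⟨ ℚᵘP.*-cong (ℚP.toℚᵘ-fromℚᵘ (ℚᵘ.mkℚᵘ (ℤ.+ m) n)) (ℚP.toℚᵘ-fromℚᵘ (ℚᵘ.mkℚᵘ (ℤ.+ suc n) 0)) ⟩
      ℚᵘ.mkℚᵘ (ℤ.+ m) n ℚᵘ.* ℚᵘ.mkℚᵘ (ℤ.+ suc n) 0                ≈⟨ ℚᵘ.*≡* numerators ⟩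
      ℚᵘ.mkℚᵘ (ℤ.+ m) 0                                            ≈⟨ ℚP.toℚᵘ-fromℚᵘ (ℚᵘ.mkℚᵘ (ℤ.+ m) 0) ⟨
      ℚ.toℚᵘ (toℚ m)                                               ∎)
      where
      open import Relation.Binary.Reasoning.Setoid ℚᵘP.≃-setoid
      numerators : ℤ.+ m ℤ.* ℤ.+ suc n ℤ.* ℤ.+ 1 ≡ ℤ.+ m ℤ.* (ℤ.+ suc n ℤ.* ℤ.+ 1)
      numerators = ℤP.*-assoc (ℤ.+ m) (ℤ.+ suc n) (ℤ.+ 1)

  toℚ-+ : ∀ m n → toℚ (m ℕ.+ n) ≡ toℚ m + toℚ n
  toℚ-+ zero    n = trans (sym (ℚP.+-identityˡ (toℚ n))) (cong (_+ toℚ n) (sym toℚ-zero))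
  toℚ-+ (suc m) n = begin
    toℚ (suc (m ℕ.+ n))     ≡⟨ toℚ-suc (m ℕ.+ n) ⟩
    1ℚ + toℚ (m ℕ.+ n)      ≡⟨ cong (1ℚ +_) (toℚ-+ m n) ⟩
    1ℚ + (toℚ m + toℚ n)    ≡⟨ ℚP.+-assoc 1ℚ (toℚ m) (toℚ n) ⟨
    1ℚ + toℚ m + toℚ n      ≡⟨ cong (_+ toℚ n) (toℚ-suc m) ⟨
    toℚ (suc m) + toℚ n     ∎
    where open ≡-Reasoning

  toℚ-* : ∀ m n → toℚ (m ℕ.* n) ≡ toℚ m * toℚ n
  toℚ-* zero    n = trans toℚ-zero (trans (sym (ℚP.*-zeroˡ (toℚ n))) (cong (_* toℚ n) (sym toℚ-zero)))
  toℚ-* (suc m) n = begin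
    toℚ (n ℕ.+ m ℕ.* n)       ≡⟨ toℚ-+ n (m ℕ.* n) ⟩
    toℚ n + toℚ (m ℕ.* n)     ≡⟨ cong (toℚ n +_) (toℚ-* m n) ⟩
    toℚ n + toℚ m * toℚ n     ≡⟨ solve 2 (λ a b → b :+ a :* b := (con 1ℚ :+ a) :* b) refl (toℚ m) (toℚ n) ⟩
    (1ℚ + toℚ m) * toℚ n      ≡⟨ cong (_* toℚ n) (toℚ-suc m) ⟨
    toℚ (suc m) * toℚ n       ∎
    where open ≡-Reasoning

  toℚ-zero-* : ∀ r → toℚ 0 * r ≡ toℚ 0
  toℚ-zero-* r = trans (cong (_* r) toℚ-zero) (trans (ℚP.*-zeroˡ r) (sym toℚ-zero))

  toℚ-mono-≤ : ∀ {m n} → m ℕ.≤ n → toℚ m ≤ toℚ n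
  toℚ-mono-≤ {m} {n} m≤n = begin
    toℚ m                    ≡⟨ ℚP.+-identityʳ (toℚ m) ⟨
    toℚ m + 0ℚ               ≤⟨ ℚP.+-monoʳ-≤ (toℚ m) (0≤toℚ (n ℕ.∸ m)) ⟩
    toℚ m + toℚ (n ℕ.∸ m)    ≡⟨ toℚ-+ m (n ℕ.∸ m) ⟨
    toℚ (m ℕ.+ (n ℕ.∸ m))    ≡⟨ cong toℚ (ℕP.m+[n∸m]≡n m≤n) ⟩
    toℚ n                    ∎
    where open ℚP.≤-Reasoning

  toℚ-mono-< : ∀ {m n} → m ℕ.< n → toℚ m < toℚ n
  toℚ-mono-< {m} {suc n} (s≤s m≤n) = begin-strict
    toℚ m          ≡⟨ ℚP.+-identityˡ (toℚ m) ⟨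
    0ℚ + toℚ m     <⟨ ℚP.+-monoˡ-< (toℚ m) (ℚP.positive⁻¹ 1ℚ) ⟩
    1ℚ + toℚ m     ≤⟨ ℚP.+-monoʳ-≤ 1ℚ (toℚ-mono-≤ m≤n) ⟩
    1ℚ + toℚ n     ≡⟨ toℚ-suc n ⟨
    toℚ (suc n)    ∎
    where open ℚP.≤-Reasoning

  0<toℚ : ∀ {m} → 1 ℕ.≤ m → 0ℚ < toℚ m
  0<toℚ {m} 1≤m = subst (_< toℚ m) toℚ-zero (toℚ-mono-< 1≤m)

  toℚ-cancel-≤ : ∀ {m n} → toℚ m ≤ toℚ n → m ℕ.≤ n
  toℚ-cancel-≤ {m} {n} le with ℕP.≤-<-connex m n
  ... | inj₁ m≤n = m≤n
  ... | inj₂ n<m = contradiction le (<⇒≱ (toℚ-mono-< n<m))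

  toℚ-suc-* : ∀ k r → toℚ (suc k) * r ≡ r + toℚ k * r
  toℚ-suc-* k r = trans (cong (_* r) (toℚ-suc k)) (solve 2 (λ k r → (con 1ℚ :+ k) :* r := r :+ k :* r) refl (toℚ k) r)

  sumFin≡sum : ∀ {N} (f : Fin N → ℕ) → sumFin f ≡ sum f
  sumFin≡sum {zero}  f = refl
  sumFin≡sum {suc N} f = cong (f zero ℕ.+_) (sumFin≡sum (λ x → f (suc x)))

  sumFin-cong : ∀ {N} {f g : Fin N → ℕ} → (∀ x → f x ≡ g x) → sumFin f ≡ sumFin g
  sumFin-cong {zero}  f≗g = refl
  sumFin-cong {suc N} f≗g = cong₂ ℕ._+_ (f≗g zero) (sumFin-cong (λ x → f≗g (suc x)))

  sumFin-zero : ∀ N → sumFin {N} (λ _ → 0) ≡ 0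
  sumFin-zero N = trans (sumFin≡sum {N} (λ _ → 0)) (sum-replicate-zero N)

  sumFin-distrib-+ : ∀ {N} (f g : Fin N → ℕ) → sumFin (λ x → f x ℕ.+ g x) ≡ sumFin f ℕ.+ sumFin g
  sumFin-distrib-+ f g = begin
    sumFin (λ x → f x ℕ.+ g x)  ≡⟨ sumFin≡sum (λ x → f x ℕ.+ g x) ⟩
    sum (λ x → f x ℕ.+ g x)     ≡⟨ ∑-distrib-+ f g ⟩
    sum f ℕ.+ sum g             ≡⟨ cong₂ ℕ._+_ (sumFin≡sum f) (sumFin≡sum g) ⟨
    sumFin f ℕ.+ sumFin g       ∎
    where open ≡-Reasoning

  sumFin-comm : ∀ {M N} (f : Fin M → Fin N → ℕ) →
    sumFin (λ x → sumFin (λ y → f x y)) ≡ sumFin (λ y → sumFin (λ x → f x y))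
  sumFin-comm f = begin
    sumFin (λ x → sumFin (f x))              ≡⟨ sumFin-cong (λ x → sumFin≡sum (f x)) ⟩
    sumFin (λ x → sum (f x))                 ≡⟨ sumFin≡sum (λ x → sum (f x)) ⟩
    sum (λ x → sum (f x))                    ≡⟨ ∑-comm f ⟩
    sum (λ y → sum (λ x → f x y))            ≡⟨ sumFin≡sum (λ y → sum (λ x → f x y)) ⟨
    sumFin (λ y → sum (λ x → f x y))         ≡⟨ sumFin-cong (λ y → sumFin≡sum (λ x → f x y)) ⟨
    sumFin (λ y → sumFin (λ x → f x y))      ∎
    where open ≡-Reasoning

  sumFin-mono-≤ : ∀ {N} {f g : Fin N → ℕ} → (∀ x → f x ℕ.≤ g x) → sumFin f ℕ.≤ sumFin g
  sumFin-mono-≤ {zero}  f≤g = z≤n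
  sumFin-mono-≤ {suc N} f≤g = ℕP.+-mono-≤ (f≤g zero) (sumFin-mono-≤ (λ x → f≤g (suc x)))

  count : ∀ {N} → (Fin N → Bool) → ℕ
  count f = sumFin (λ x → if f x then 1 else 0)

  count-cong : ∀ {N} {f g : Fin N → Bool} → (∀ x → f x ≡ g x) → count f ≡ count g
  count-cong f≗g = sumFin-cong (λ x → cong (if_then 1 else 0) (f≗g x))

  count-mono : ∀ {N} {f g : Fin N → Bool} → (∀ x → f x ≡ true → g x ≡ true) → count f ℕ.≤ count g
  count-mono {f = f} {g} f⊆g = sumFin-mono-≤ indicator-≤
    where
    indicator-≤ : ∀ x → (if f x then 1 else 0) ℕ.≤ (if g x then 1 else 0)
    indicator-≤ x with f x | f⊆g x
    ... | false | _   = z≤n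
    ... | true  | fx⇒gx rewrite fx⇒gx refl = ℕP.≤-refl

  count-split : ∀ {N} (f g : Fin N → Bool) → count f ≡ count (λ x → f x ∧ g x) ℕ.+ count (λ x → f x ∧ not (g x))
  count-split f g = trans (sumFin-cong indicator-split)
    (sumFin-distrib-+ (λ x → if f x ∧ g x then 1 else 0) (λ x → if f x ∧ not (g x) then 1 else 0))
    where
    indicator-split : ∀ x → (if f x then 1 else 0) ≡ (if f x ∧ g x then 1 else 0) ℕ.+ (if f x ∧ not (g x) then 1 else 0)
    indicator-split x with f x | g x
    ... | false | _     = refl
    ... | true  | true  = refl
    ... | true  | false = refl

  1≤count : ∀ {N} (f : Fin N → Bool) {y} → f y ≡ true → 1 ℕ.≤ count f
  1≤count f {zero}  fy rewrite fy = s≤s z≤n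
  1≤count f {suc y} fy = ℕP.≤-trans (1≤count (λ x → f (suc x)) fy) (ℕP.m≤n+m _ (if f zero then 1 else 0))

  1≤count⇒∃ : ∀ {N} (f : Fin N → Bool) → 1 ℕ.≤ count f → ∃ λ y → f y ≡ true
  1≤count⇒∃ {suc N} f 1≤cf with f zero in fzero
  ... | true  = zero , fzero
  ... | false = let y , fy = 1≤count⇒∃ (λ x → f (suc x)) 1≤cf in suc y , fy

  _≡ᵇ_ : ∀ {N} → Fin N → Fin N → Bool
  x ≡ᵇ y = does (x Fin.≟ y)

  ≡ᵇ-refl : ∀ {N} (x : Fin N) → (x ≡ᵇ x) ≡ true
  ≡ᵇ-refl x = dec-true (x Fin.≟ x) refl

  does⇒ : ∀ {P : Set} (P? : Dec P) → does P? ≡ true → P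
  does⇒ (yes p) _ = p

  ¬does⇒¬ : ∀ {P : Set} (P? : Dec P) → does P? ≡ false → ¬ P
  ¬does⇒¬ (no ¬p) _ = ¬p

  count-≡ᵇ≤1 : ∀ {N} (y : Fin N) → count (_≡ᵇ y) ℕ.≤ 1
  count-≡ᵇ≤1 {suc N} zero = ℕP.≤-reflexive (cong suc (sumFin-zero N))
  count-≡ᵇ≤1 {suc N} (suc y) = ℕP.≤-trans (ℕP.≤-reflexive (count-cong suc≡ᵇsuc)) (count-≡ᵇ≤1 y)
    where
    suc≡ᵇsuc : ∀ x → (suc x ≡ᵇ suc y) ≡ (x ≡ᵇ y)
    suc≡ᵇsuc x with x Fin.≟ y
    ... | yes _ = refl
    ... | no  _ = refl

  count-remove : ∀ {N} (f : Fin N → Bool) (y : Fin N) → count f ℕ.≤ suc (count (λ x → f x ∧ not (x ≡ᵇ y)))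
  count-remove f y = begin
    count f                                                        ≡⟨ count-split f (λ x → not (x ≡ᵇ y)) ⟩
    count (λ x → f x ∧ not (x ≡ᵇ y)) ℕ.+ count (λ x → f x ∧ not (not (x ≡ᵇ y)))
      ≤⟨ ℕP.+-monoʳ-≤ (count (λ x → f x ∧ not (x ≡ᵇ y))) (ℕP.≤-trans (count-mono only-y) (count-≡ᵇ≤1 y)) ⟩
    count (λ x → f x ∧ not (x ≡ᵇ y)) ℕ.+ 1                         ≡⟨ ℕP.+-comm _ 1 ⟩
    suc (count (λ x → f x ∧ not (x ≡ᵇ y)))                         ∎
    where
    open ℕP.≤-Reasoning
    only-y : ∀ x → f x ∧ not (not (x ≡ᵇ y)) ≡ true → (x ≡ᵇ y) ≡ true
    only-y x e = trans (sym (BoolP.not-involutive (x ≡ᵇ y))) (BoolP.∧-conicalʳ (f x) _ e)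

  witnesses : ∀ {N} → (Fin N → Bool) → List (Fin N)
  witnesses {zero}  f = []
  witnesses {suc N} f with f zero
  ... | true  = zero ∷ List.map suc (witnesses (λ x → f (suc x)))
  ... | false = List.map suc (witnesses (λ x → f (suc x)))

  length-witnesses : ∀ {N} (f : Fin N → Bool) → length (witnesses f) ≡ count f
  length-witnesses {zero}  f = refl
  length-witnesses {suc N} f with f zero
  ... | true  = cong suc (trans (ListP.length-map suc (witnesses (λ x → f (suc x)))) (length-witnesses (λ x → f (suc x))))
  ... | false = trans (ListP.length-map suc (witnesses (λ x → f (suc x)))) (length-witnesses (λ x → f (suc x)))

  ∈-witnesses⁻ : ∀ {N} (f : Fin N → Bool) {x} → x ∈ witnesses f → f x ≡ true
  ∈-witnesses⁻ {suc N} f {x} x∈ with f zero in fzero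
  ∈-witnesses⁻ {suc N} f (here refl) | true = fzero
  ∈-witnesses⁻ {suc N} f (there x∈) | true with ∈-map⁻ suc x∈
  ... | _ , x∈′ , refl = ∈-witnesses⁻ (λ z → f (suc z)) x∈′
  ∈-witnesses⁻ {suc N} f x∈ | false with ∈-map⁻ suc x∈
  ... | _ , x∈′ , refl = ∈-witnesses⁻ (λ z → f (suc z)) x∈′

  witnesses-unique : ∀ {N} (f : Fin N → Bool) → Unique (witnesses f)
  witnesses-unique {zero}  f = []
  witnesses-unique {suc N} f with f zero
  ... | true  = All.tabulate zero∉ ∷ UniqueP.map⁺ FinP.suc-injective (witnesses-unique (λ x → f (suc x)))
    where
    zero∉ : ∀ {y} → y ∈ List.map suc (witnesses (λ x → f (suc x))) → zero ≢ y
    zero∉ y∈ zero≡y with ∈-map⁻ suc y∈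
    zero∉ y∈ () | _ , _ , refl
  ... | false = UniqueP.map⁺ FinP.suc-injective (witnesses-unique (λ x → f (suc x)))

  sumWhere : ∀ {N} → (Fin N → Bool) → (Fin N → ℕ) → ℕ
  sumWhere B h = sumFin (λ y → if B y then h y else 0)

  sumWhere-≤ : ∀ {N} (B : Fin N → Bool) (h : Fin N → ℕ) (r : ℚ) → (∀ y → B y ≡ true → toℚ (h y) ≤ r) →
    toℚ (sumWhere B h) ≤ toℚ (count B) * r
  sumWhere-≤ {zero}  B h r h≤r = ℚP.≤-reflexive (sym (toℚ-zero-* r))
  sumWhere-≤ {suc N} B h r h≤r with B zero in bzero
  ... | false = sumWhere-≤ (λ y → B (suc y)) (λ y → h (suc y)) r (λ y → h≤r (suc y))
  ... | true  = begin
    toℚ (h zero ℕ.+ sumWhere B′ h′)          ≡⟨ toℚ-+ (h zero) (sumWhere B′ h′) ⟩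
    toℚ (h zero) + toℚ (sumWhere B′ h′)      ≤⟨ ℚP.+-mono-≤ (h≤r zero bzero) (sumWhere-≤ B′ h′ r (λ y → h≤r (suc y))) ⟩
    r + toℚ (count B′) * r                   ≡⟨ toℚ-suc-* (count B′) r ⟨
    toℚ (suc (count B′)) * r                 ∎
    where
    open ℚP.≤-Reasoning
    B′ = λ y → B (suc y)
    h′ = λ y → h (suc y)

  sumWhere-< : ∀ {N} (B : Fin N → Bool) (h : Fin N → ℕ) (r : ℚ) → (∀ y → B y ≡ true → toℚ (h y) < r) →
    ∀ {y₀} → B y₀ ≡ true → toℚ (sumWhere B h) < toℚ (count B) * r
  sumWhere-< {suc N} B h r h<r {y₀} By₀ with B zero in bzero | y₀
  ... | true  | _ = begin-strict
    toℚ (h zero ℕ.+ sumWhere B′ h′)          ≡⟨ toℚ-+ (h zero) (sumWhere B′ h′) ⟩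
    toℚ (h zero) + toℚ (sumWhere B′ h′)      <⟨ ℚP.+-mono-<-≤ (h<r zero bzero) (sumWhere-≤ B′ h′ r (λ y e → ℚP.<⇒≤ (h<r (suc y) e))) ⟩
    r + toℚ (count B′) * r                   ≡⟨ toℚ-suc-* (count B′) r ⟨
    toℚ (suc (count B′)) * r                 ∎
    where
    open ℚP.≤-Reasoning
    B′ = λ y → B (suc y)
    h′ = λ y → h (suc y)
  ... | false | zero   = contradiction (trans (sym bzero) By₀) λ ()
  ... | false | suc y₀ = sumWhere-< (λ y → B (suc y)) (λ y → h (suc y)) r (λ y → h<r (suc y)) By₀

  fromℕ-or-inject₁ : ∀ {n} (i : Fin (suc n)) → i ≡ fromℕ n ⊎ ∃ λ i′ → i ≡ inject₁ i′
  fromℕ-or-inject₁ {zero}  zero    = inj₁ refl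
  fromℕ-or-inject₁ {suc n} zero    = inj₂ (zero , refl)
  fromℕ-or-inject₁ {suc n} (suc i) with fromℕ-or-inject₁ i
  ... | inj₁ i≡n         = inj₁ (cong suc i≡n)
  ... | inj₂ (i′ , i≡i′) = inj₂ (suc i′ , cong suc i≡i′)

  module _ {A : Set} where

    lookup-∷ʳ-inject₁ : ∀ {n} (xs : Vec A n) y (i : Fin n) → lookup (xs ∷ʳ y) (inject₁ i) ≡ lookup xs i
    lookup-∷ʳ-inject₁ (x ∷ xs) y zero    = refl
    lookup-∷ʳ-inject₁ (x ∷ xs) y (suc i) = lookup-∷ʳ-inject₁ xs y i

    lookup-∷ʳ-fromℕ : ∀ {n} (xs : Vec A n) y → lookup (xs ∷ʳ y) (fromℕ n) ≡ y
    lookup-∷ʳ-fromℕ []       y = refl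
    lookup-∷ʳ-fromℕ (x ∷ xs) y = lookup-∷ʳ-fromℕ xs y

    head-∷ʳ : ∀ {n} (xs : Vec A (suc n)) y → Vec.head (xs ∷ʳ y) ≡ Vec.head xs
    head-∷ʳ (x ∷ xs) y = refl

    Distinct : ∀ {n} → Vec A n → Set
    Distinct xs = ∀ i j → lookup xs i ≡ lookup xs j → i ≡ j

    steps-∷ʳ : ∀ {n} (E : A → A → Set) (xs : Vec A (suc n)) y →
      (∀ (i : Fin n) → E (lookup xs (inject₁ i)) (lookup xs (suc i))) → E (lookup xs (fromℕ n)) y →
      ∀ (i : Fin (suc n)) → E (lookup (xs ∷ʳ y) (inject₁ i)) (lookup (xs ∷ʳ y) (suc i))
    steps-∷ʳ {n} E xs y old new i with fromℕ-or-inject₁ i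
    ... | inj₁ refl        = subst₂ E (sym (lookup-∷ʳ-inject₁ xs y (fromℕ n))) (sym (lookup-∷ʳ-fromℕ xs y)) new
    ... | inj₂ (i′ , refl) = subst₂ E (sym (lookup-∷ʳ-inject₁ xs y (inject₁ i′))) (sym (lookup-∷ʳ-inject₁ xs y (suc i′))) (old i′)

  _∈ᵇ_ : ∀ {N k} → Fin N → Vec (Fin N) k → Bool
  x ∈ᵇ []       = false
  x ∈ᵇ (y ∷ ys) = x ≡ᵇ y ∨ x ∈ᵇ ys

  ∈ᵇ-∷ʳ : ∀ {N k} (x : Fin N) (ys : Vec (Fin N) k) y → x ∈ᵇ (ys ∷ʳ y) ≡ x ∈ᵇ ys ∨ x ≡ᵇ y
  ∈ᵇ-∷ʳ x []       y = BoolP.∨-identityʳ (x ≡ᵇ y)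
  ∈ᵇ-∷ʳ x (z ∷ ys) y = trans (cong (x ≡ᵇ z ∨_) (∈ᵇ-∷ʳ x ys y)) (sym (BoolP.∨-assoc (x ≡ᵇ z) (x ∈ᵇ ys) (x ≡ᵇ y)))

  ∈ᵇ-lookup : ∀ {N k} (ys : Vec (Fin N) k) (i : Fin k) → lookup ys i ∈ᵇ ys ≡ true
  ∈ᵇ-lookup (y ∷ ys) zero    rewrite ≡ᵇ-refl y = refl
  ∈ᵇ-lookup (y ∷ ys) (suc i) rewrite ∈ᵇ-lookup ys i = BoolP.∨-zeroʳ (lookup ys i ≡ᵇ y)

  ∉ᵇ⇒≢lookup : ∀ {N k} {y : Fin N} (xs : Vec (Fin N) k) → y ∈ᵇ xs ≡ false → ∀ i → y ≢ lookup xs i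
  ∉ᵇ⇒≢lookup xs y∉xs i refl = contradiction (trans (sym y∉xs) (∈ᵇ-lookup xs i)) λ ()

  distinct-∷ʳ : ∀ {N k} (xs : Vec (Fin N) k) y → Distinct xs → y ∈ᵇ xs ≡ false → Distinct (xs ∷ʳ y)
  distinct-∷ʳ xs y distinct y∉xs i j eq with fromℕ-or-inject₁ i | fromℕ-or-inject₁ j
  ... | inj₁ refl        | inj₁ refl        = refl
  ... | inj₁ refl        | inj₂ (j′ , refl) = ⊥-elim (∉ᵇ⇒≢lookup xs y∉xs j′
    (trans (sym (lookup-∷ʳ-fromℕ xs y)) (trans eq (lookup-∷ʳ-inject₁ xs y j′))))
  ... | inj₂ (i′ , refl) | inj₁ refl        = ⊥-elim (∉ᵇ⇒≢lookup xs y∉xs i′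
    (trans (sym (lookup-∷ʳ-fromℕ xs y)) (trans (sym eq) (lookup-∷ʳ-inject₁ xs y i′))))
  ... | inj₂ (i′ , refl) | inj₂ (j′ , refl) =
    cong inject₁ (distinct i′ j′ (trans (sym (lookup-∷ʳ-inject₁ xs y i′)) (trans eq (lookup-∷ʳ-inject₁ xs y j′))))

  Unique⇒lookup-injective : ∀ {A : Set} {xs : List A} → Unique xs → ∀ i j → List.lookup xs i ≡ List.lookup xs j → i ≡ j
  Unique⇒lookup-injective (x∉ ∷ u) zero    zero    _  = refl
  Unique⇒lookup-injective (x∉ ∷ u) zero    (suc j) eq = ⊥-elim (All.lookup x∉ (∈-lookup j) eq)
  Unique⇒lookup-injective (x∉ ∷ u) (suc i) zero    eq = ⊥-elim (All.lookup x∉ (∈-lookup i) (sym eq))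
  Unique⇒lookup-injective (x∉ ∷ u) (suc i) (suc j) eq = cong suc (Unique⇒lookup-injective u i j eq)

  module _ {N : ℕ} where

    remove : ∀ {k} → VSet N → Vec (Fin N) k → VSet N
    remove X p = Vec.tabulate λ y → lookup X y ∧ not (y ∈ᵇ p)

    lookup-remove : ∀ {k} (X : VSet N) (p : Vec (Fin N) k) y → lookup (remove X p) y ≡ (lookup X y ∧ not (y ∈ᵇ p))
    lookup-remove X p y = VecP.lookup∘tabulate (λ z → lookup X z ∧ not (z ∈ᵇ p)) y

    remove-[] : ∀ (X : VSet N) y → lookup (remove X []) y ≡ lookup X y
    remove-[] X y = trans (lookup-remove X [] y) (BoolP.∧-identityʳ (lookup X y))

    remove-∷ʳ-∉ : ∀ {k} (X : VSet N) (p : Vec (Fin N) k) {y} → lookup X y ≡ false →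
      ∀ z → lookup (remove X (p ∷ʳ y)) z ≡ lookup (remove X p) z
    remove-∷ʳ-∉ X p {y} y∉X z = begin
      lookup (remove X (p ∷ʳ y)) z          ≡⟨ lookup-remove X (p ∷ʳ y) z ⟩
      lookup X z ∧ not (z ∈ᵇ (p ∷ʳ y))      ≡⟨ cong (λ w → lookup X z ∧ not w) (∈ᵇ-∷ʳ z p y) ⟩
      lookup X z ∧ not (z ∈ᵇ p ∨ z ≡ᵇ y)    ≡⟨ drop-y (z Fin.≟ y) ⟩
      lookup X z ∧ not (z ∈ᵇ p)             ≡⟨ lookup-remove X p z ⟨
      lookup (remove X p) z                 ∎
      where
      open ≡-Reasoning
      drop-y : (z≟y : Dec (z ≡ y)) → (lookup X z ∧ not (z ∈ᵇ p ∨ does z≟y)) ≡ (lookup X z ∧ not (z ∈ᵇ p))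
      drop-y (no  _)    = cong (λ w → lookup X z ∧ not w) (BoolP.∨-identityʳ (z ∈ᵇ p))
      drop-y (yes refl) rewrite y∉X = refl

    size-remove-∷ʳ : ∀ {k} (X : VSet N) (p : Vec (Fin N) k) y → size (remove X p) ℕ.≤ suc (size (remove X (p ∷ʳ y)))
    size-remove-∷ʳ X p y = ℕP.≤-trans (count-remove (lookup (remove X p)) y) (s≤s (ℕP.≤-reflexive (count-cong removed)))
      where
      removed : ∀ z → (lookup (remove X p) z ∧ not (z ≡ᵇ y)) ≡ lookup (remove X (p ∷ʳ y)) z
      removed z rewrite lookup-remove X p z | lookup-remove X (p ∷ʳ y) z | ∈ᵇ-∷ʳ z p y = ∧-not-∨ (lookup X z) (z ∈ᵇ p) (z ≡ᵇ y)
        where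
        ∧-not-∨ : ∀ a b c → ((a ∧ not b) ∧ not c) ≡ (a ∧ not (b ∨ c))
        ∧-not-∨ false _     _ = refl
        ∧-not-∨ true  true  _ = refl
        ∧-not-∨ true  false _ = refl

    size-cong : ∀ (X Y : VSet N) → (∀ y → lookup X y ≡ lookup Y y) → size X ≡ size Y
    size-cong X Y = count-cong

    degIn-cong : ∀ (G : Graph N) (X Y : VSet N) z → (∀ y → lookup X y ≡ lookup Y y) → degIn G X z ≡ degIn G Y z
    degIn-cong G X Y z X≗Y = count-cong (λ u → cong (_∧ adj G z u) (X≗Y u))

  module _ {A : Set} {k : ℕ} (next : Vec A k → List A) where

    extensions : List (Vec A k) → List (Vec A (suc k))
    extensions []       = []
    extensions (p ∷ ps) = List.map (p ∷ʳ_) (next p) ++ extensions ps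

    ∈-extensions⁻ : ∀ ps {q} → q ∈ extensions ps → ∃ λ p → ∃ λ y → p ∈ ps × y ∈ next p × q ≡ p ∷ʳ y
    ∈-extensions⁻ (p ∷ ps) q∈ with ∈-++⁻ (List.map (p ∷ʳ_) (next p)) q∈
    ... | inj₁ q∈here with ∈-map⁻ (p ∷ʳ_) q∈here
    ...   | y , y∈ , q≡ = p , y , here refl , y∈ , q≡
    ∈-extensions⁻ (p ∷ ps) q∈ | inj₂ q∈rest with ∈-extensions⁻ ps q∈rest
    ...   | p′ , y , p′∈ , y∈ , q≡ = p′ , y , there p′∈ , y∈ , q≡

    extensions-unique : ∀ ps → Unique ps → (∀ p → Unique (next p)) → Unique (extensions ps)
    extensions-unique []       _        _ = []
    extensions-unique (p ∷ ps) (p∉ ∷ u) u-next = UniqueP.++⁺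
      (UniqueP.map⁺ (VecP.∷ʳ-injectiveʳ p p) (u-next p)) (extensions-unique ps u u-next) here-rest-disjoint
      where
      here-rest-disjoint : ∀ {q} → ¬ (q ∈ List.map (p ∷ʳ_) (next p) × q ∈ extensions ps)
      here-rest-disjoint (q∈here , q∈rest) with ∈-map⁻ (p ∷ʳ_) q∈here | ∈-extensions⁻ ps q∈rest
      ... | _ , _ , refl | p′ , _ , p′∈ , _ , eq = All.lookup p∉ p′∈ (VecP.∷ʳ-injectiveˡ p p′ eq)

    extensions-all : ∀ (P : Vec A (suc k) → Set) ps → (∀ {p} → p ∈ ps → ∀ {y} → y ∈ next p → P (p ∷ʳ y)) →
      All P (extensions ps)
    extensions-all P ps P-ext = All.tabulate λ q∈ → case ∈-extensions⁻ ps q∈ of λ where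
      (_ , _ , p∈ , y∈ , refl) → P-ext p∈ y∈

    length-extensions : ∀ ps (r : ℚ) → (∀ {p} → p ∈ ps → r ≤ toℚ (length (next p))) →
      toℚ (length ps) * r ≤ toℚ (length (extensions ps))
    length-extensions []       r _      = ℚP.≤-reflexive (toℚ-zero-* r)
    length-extensions (p ∷ ps) r r≤next = begin
      toℚ (suc (length ps)) * r                              ≡⟨ toℚ-suc-* (length ps) r ⟩
      r + toℚ (length ps) * r                                ≤⟨ ℚP.+-mono-≤ (r≤next (here refl)) (length-extensions ps r (r≤next ∘ there)) ⟩
      toℚ (length (next p)) + toℚ (length (extensions ps))   ≡⟨ toℚ-+ (length (next p)) (length (extensions ps)) ⟨
      toℚ (length (next p) ℕ.+ length (extensions ps))       ≡⟨ cong toℚ length-p∷ps ⟨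
      toℚ (length (extensions (p ∷ ps)))                     ∎
      where
      open ℚP.≤-Reasoning
      length-p∷ps : length (extensions (p ∷ ps)) ≡ length (next p) ℕ.+ length (extensions ps)
      length-p∷ps = trans (ListP.length-++ (List.map (p ∷ʳ_) (next p))) (cong (ℕ._+ length (extensions ps)) (ListP.length-map (p ∷ʳ_) (next p)))

  module _ (ε : ℝ) where

    Lo<Up : ∀ {p q} → Lo ε p → Up ε q → p < q
    Lo<Up {p} {q} lo up with ℚP.<-cmp p q
    ... | tri< p<q _ _ = p<q
    ... | tri≈ _ refl _ = ⊥-elim (disjoint ε p (lo , up))
    ... | tri> _ _ q<p = ⊥-elim (disjoint ε q (roundedL← ε q p q<p lo , up))

    Lo-downwards-closed : ∀ {p q} → q ≤ p → Lo ε p → Lo ε q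
    Lo-downwards-closed {p} {q} q≤p lo with ℚP.<-cmp q p
    ... | tri< q<p _ _ = roundedL← ε q p q<p lo
    ... | tri≈ _ refl _ = lo
    ... | tri> _ _ p<q = contradiction q≤p (<⇒≱ p<q)

    -- A ratio β/σ that is not above ε factors as b·q with q < √ε, for any b > √ε:
    -- take q = (β/σ)/b, then q² < β/σ because β/σ < b², and locatedness decides q² < ε.
    below-ε⇒b*below-√ε : ∀ {b β σ} → SqrtUpper ε b → 0ℚ < β → 0ℚ < σ → ¬ (∀ p → Lo ε p → p * σ ≤ β) →
      ∃ λ q → SqrtLower ε q × β ≡ b * q * σ
    below-ε⇒b*below-√ε {b} {β} {σ} (0<b , b²>ε) 0<β 0<σ not-above = [ below , above ]′ (located ε (q * q) t q²<t)
      where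
      instance
        σ≢0 : ℚ.NonZero σ
        σ≢0 = ℚP.pos⇒nonZero σ {{ℚ.positive 0<σ}}
        b≢0 : ℚ.NonZero b
        b≢0 = ℚP.pos⇒nonZero b {{ℚ.positive 0<b}}
      t q : ℚ
      t = β * ℚ.1/ σ
      q = t * ℚ.1/ b
      tσ≡β : t * σ ≡ β
      tσ≡β = trans (ℚP.*-assoc β (ℚ.1/ σ) σ) (trans (cong (β *_) (ℚP.*-inverseˡ σ)) (ℚP.*-identityʳ β))
      qb≡t : q * b ≡ t
      qb≡t = trans (ℚP.*-assoc t (ℚ.1/ b) b) (trans (cong (t *_) (ℚP.*-inverseˡ b)) (ℚP.*-identityʳ t))
      t-not-above : ¬ (∀ p → Lo ε p → p ≤ t)
      t-not-above p≤t = not-above λ p p<ε → subst (p * σ ≤_) tσ≡β (ℚP.*-monoʳ-≤-nonNeg σ {{ℚ.nonNegative (ℚP.<⇒≤ 0<σ)}} (p≤t p p<ε))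
      0<t : 0ℚ < t
      0<t = 0<p*q 0<β (ℚP.positive⁻¹ (ℚ.1/ σ) {{ℚP.1/pos⇒pos σ {{ℚ.positive 0<σ}}}})
      0≤q : 0ℚ ≤ q
      0≤q = 0≤p*q (ℚP.<⇒≤ 0<t) (ℚP.<⇒≤ (ℚP.positive⁻¹ (ℚ.1/ b) {{ℚP.1/pos⇒pos b {{ℚ.positive 0<b}}}}))
      t<b² : t < b * b
      t<b² = ℚP.≰⇒> λ b²≤t → t-not-above λ p p<ε → ℚP.≤-trans (ℚP.<⇒≤ (Lo<Up p<ε b²>ε)) b²≤t
      q²<t : q * q < t
      q²<t = ℚP.*-cancelʳ-<-nonNeg (b * b) {{ℚ.nonNegative (ℚP.<⇒≤ (0<p*q 0<b 0<b))}} (begin-strict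
        q * q * (b * b)   ≡⟨ solve 2 (λ q b → q :* q :* (b :* b) := (q :* b) :* (q :* b)) refl q b ⟩
        (q * b) * (q * b) ≡⟨ cong₂ _*_ qb≡t qb≡t ⟩
        t * t             <⟨ ℚP.*-monoʳ-<-pos t {{ℚ.positive 0<t}} t<b² ⟩
        t * (b * b)       ∎)
        where open ℚP.≤-Reasoning
      below : Lo ε (q * q) → ∃ λ q → SqrtLower ε q × β ≡ b * q * σ
      below q²<ε = q , inj₂ (0≤q , q²<ε) , trans (sym tσ≡β) (cong (_* σ) (trans (sym qb≡t) (ℚP.*-comm q b)))
      above : Up ε t → ∃ λ q → SqrtLower ε q × β ≡ b * q * σ
      above t>ε = contradiction (λ p p<ε → ℚP.<⇒≤ (Lo<Up p<ε t>ε)) t-not-above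

  module ShortPath (ε : ℝ) (n l : ℕ) (0<ε : Lo ε 0ℚ)
    (l<2n[1-√ε] : ∀ q → SqrtLower ε q → toℚ (suc l) ≤ toℚ (2 ℕ.* n) * (1ℚ - q)) where

    suc-l≤2n : suc l ℕ.≤ 2 ℕ.* n
    suc-l≤2n = toℚ-cancel-≤ {suc l} {2 ℕ.* n} (subst (toℚ (suc l) ≤_) (ℚP.*-identityʳ (toℚ (2 ℕ.* n))) (l<2n[1-√ε] 0ℚ (inj₂ (ℚP.≤-refl , 0<ε))))

    1≤n : 1 ℕ.≤ n
    1≤n = ℕP.*-cancelˡ-< 2 0 n (ℕP.≤-trans (s≤s z≤n) suc-l≤2n)

    SqrtLower⇒<1 : ∀ {q} → SqrtLower ε q → q < 1ℚ
    SqrtLower⇒<1 {q} q<√ε = ℚP.≰⇒> 1≰q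
      where
      1≰q : ¬ 1ℚ ≤ q
      1≰q 1≤q = contradiction (toℚ-cancel-≤ {suc l} {0} (ℚP.≤-trans (l<2n[1-√ε] q q<√ε) (ℚP.≤-trans 2n[1-q]≤0 (ℚP.≤-reflexive (sym toℚ-zero))))) λ ()
        where
        2n[1-q]≤0 : toℚ (2 ℕ.* n) * (1ℚ - q) ≤ 0ℚ
        2n[1-q]≤0 = ≤-via-difference (solve 2 (λ m q → con 0ℚ :- m :* (con 1ℚ :- q) := m :* (q :- con 1ℚ)) refl (toℚ (2 ℕ.* n)) q)
          (0≤p*q (0≤toℚ (2 ℕ.* n)) (p≤q⇒0≤q-p 1≤q))

    -- ε < 1 gives ε² < ε, so every nonnegative p < ε is also below √ε.
    Lo⇒SqrtLower : ∀ {p} → Lo ε p → 0ℚ ≤ p → SqrtLower ε p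
    Lo⇒SqrtLower {p} p<ε 0≤p = inj₂ (0≤p , Lo-downwards-closed ε p*p≤p p<ε)
      where
      p<1 : p < 1ℚ
      p<1 = ℚP.≰⇒> λ 1≤p → ℚP.<-irrefl refl (SqrtLower⇒<1 (inj₂ (ℚP.<⇒≤ (ℚP.positive⁻¹ 1ℚ) , Lo-downwards-closed ε 1≤p p<ε)))
      p*p≤p : p * p ≤ p
      p*p≤p = ≤-via-difference (solve 1 (λ p → p :- p :* p := p :* (con 1ℚ :- p)) refl p) (0≤p*q 0≤p (ℚP.<⇒≤ (p<q⇒0<q-p p<1)))

    -- Of s ≥ n vertices, m survive the removal of k ≤ l/2; the last summand is nonnegative as 2k ≤ l < 2n(1 - q).
    survivors-large : ∀ {m k s} → n ℕ.≤ s → s ℕ.≤ m ℕ.+ k → 2 ℕ.* k ℕ.≤ l →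
      ∀ q → SqrtLower ε q → q * toℚ s ≤ toℚ m
    survivors-large {m} {k} {s} n≤s s≤m+k 2k≤l q q<√ε = ≤-via-difference
      (solve 5 (λ M K S N q → M :- q :* S := ((M :+ K) :- S) :+ (S :- N) :* (con 1ℚ :- q) :+ (N :* (con 1ℚ :- q) :- K))
        refl (toℚ m) (toℚ k) (toℚ s) (toℚ n) q)
      (ℚP.+-mono-≤ (ℚP.+-mono-≤ (p≤q⇒0≤q-p s≤m+k′) (0≤p*q (p≤q⇒0≤q-p (toℚ-mono-≤ n≤s)) (ℚP.<⇒≤ (p<q⇒0<q-p (SqrtLower⇒<1 q<√ε))))) 0≤n[1-q]-k)
      where
      s≤m+k′ : toℚ s ≤ toℚ m + toℚ k
      s≤m+k′ = subst (toℚ s ≤_) (toℚ-+ m k) (toℚ-mono-≤ s≤m+k)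
      toℚ-double : ∀ j → toℚ (2 ℕ.* j) ≡ toℚ j + toℚ j
      toℚ-double j = trans (toℚ-+ j (j ℕ.+ 0)) (cong (λ z → toℚ j + toℚ z) (ℕP.+-identityʳ j))
      2k≤2n[1-q] : toℚ k + toℚ k ≤ (toℚ n + toℚ n) * (1ℚ - q)
      2k≤2n[1-q] = subst₂ (λ z w → z ≤ w * (1ℚ - q)) (toℚ-double k) (toℚ-double n)
        (ℚP.≤-trans (toℚ-mono-≤ {2 ℕ.* k} {suc l} (ℕP.m≤n⇒m≤1+n 2k≤l)) (l<2n[1-√ε] q q<√ε))
      0≤n[1-q]-k : 0ℚ ≤ toℚ n * (1ℚ - q) - toℚ k
      0≤n[1-q]-k = 0≤p+p⇒0≤p (subst (0ℚ ≤_)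
        (solve 3 (λ N q K → (N :+ N) :* (con 1ℚ :- q) :- (K :+ K) := (N :* (con 1ℚ :- q) :- K) :+ (N :* (con 1ℚ :- q) :- K))
          refl (toℚ n) q (toℚ k))
        (p≤q⇒0≤q-p 2k≤2n[1-q]))

    survivors-ε-large : ∀ {m k s} → n ℕ.≤ s → s ℕ.≤ m ℕ.+ k → 2 ℕ.* k ℕ.≤ l → RealTimesLe ε s m
    survivors-ε-large {m} {k} {s} n≤s s≤m+k 2k≤l = RealTimesLe⁺ ε s m below-ε
      where
      below-ε : ∀ p → Lo ε p → p * toℚ s ≤ toℚ m
      below-ε p p<ε with ℚP.≤-total p 0ℚ
      ... | inj₂ 0≤p = survivors-large {m} {k} {s} n≤s s≤m+k 2k≤l p (Lo⇒SqrtLower p<ε 0≤p)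
      ... | inj₁ p≤0 = ℚP.≤-trans (≤-via-difference (solve 2 (λ p s → con 0ℚ :- p :* s := (con 0ℚ :- p) :* s) refl p (toℚ s))
                                     (0≤p*q (p≤q⇒0≤q-p p≤0) (0≤toℚ s)))
                                  (0≤toℚ m)

    survivors-nonempty : ∀ {m k s} → n ℕ.≤ s → s ℕ.≤ m ℕ.+ k → 2 ℕ.* k ℕ.≤ l → 1 ℕ.≤ m
    survivors-nonempty {m} {k} n≤s s≤m+k 2k≤l = ℕP.+-cancelʳ-< k 0 m (ℕP.<-≤-trans k<n (ℕP.≤-trans n≤s s≤m+k))
      where
      k<n : k ℕ.< n
      k<n = ℕP.*-cancelˡ-< 2 k n (ℕP.≤-<-trans 2k≤l suc-l≤2n)

  module _ {N} (G : Graph N) where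

    edges≡sumWhere-degIn : ∀ B R → edges G B R ≡ sumWhere (lookup B) (degIn G R)
    edges≡sumWhere-degIn B R = sumFin-cong row
      where
      row : ∀ y → sumFin (λ u → if lookup B y ∧ lookup R u ∧ adj G y u then 1 else 0) ≡ (if lookup B y then degIn G R y else 0)
      row y with lookup B y
      ... | true  = refl
      ... | false = sumFin-zero N

    edges-comm : ∀ X Y → edges G X Y ≡ edges G Y X
    edges-comm X Y = trans (sumFin-comm (λ x y → if lookup X x ∧ lookup Y y ∧ adj G x y then 1 else 0))
      (sumFin-cong λ y → sumFin-cong λ x → cong (if_then 1 else 0) (swap (lookup X x) (lookup Y y) (adj-sym G x y)))
      where
      swap : ∀ a b {c d} → c ≡ d → (a ∧ b ∧ c) ≡ (b ∧ a ∧ d)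
      swap true  true  c≡d = c≡d
      swap true  false _   = refl
      swap false true  _   = refl
      swap false false _   = refl

    density-lower-bound⇒edges : ∀ {c} X Y → c ≤ density G X Y → 1 ℕ.≤ size X ℕ.* size Y →
      c * toℚ (size X ℕ.* size Y) ≤ toℚ (edges G X Y)
    density-lower-bound⇒edges {c} X Y c≤d 1≤|X||Y| with size X ℕ.* size Y | 1≤|X||Y|
    ... | suc k | _ = begin
      c * toℚ (suc k)                                ≤⟨ ℚP.*-monoʳ-≤-nonNeg (toℚ (suc k)) {{ℚ.nonNegative (0≤toℚ (suc k))}} c≤d ⟩
      (ℤ.+ edges G X Y ℚ./ suc k) * toℚ (suc k)      ≡⟨ m/n*n≡m (edges G X Y) k ⟩
      toℚ (edges G X Y)                              ∎
      where open ℚP.≤-Reasoning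

  module _ {N} (G : Graph N) (ε : ℝ) (U V : VSet N) {a : ℚ}
    (regular : Regular G ε U V) (0≤a : 0ℚ ≤ a) (a>ε : Up ε a) where

    regular⇒density-≥ : ∀ X Y → X ⊆ᵥ U → Y ⊆ᵥ V → RealTimesLe ε (size U) (size X) → RealTimesLe ε (size V) (size Y) →
      density G U V - a ≤ density G X Y
    regular⇒density-≥ X Y X⊆U Y⊆V X-large Y-large = ∣p-q∣≤r⇒q-r≤p 0≤a ∣δ∣≤a
      where
      ∣δ∣≤a : ℚ.∣ density G X Y - density G U V ∣ ≤ a
      ∣δ∣≤a = regular X Y X⊆U Y⊆V X-large Y-large a a>ε

  module GreedyPaths {N} (G : Graph N) (ε : ℝ) (U V : VSet N) (n l : ℕ) {d a b : ℚ}
    (U∩V≡∅ : Disjoint U V) (n≤|U| : n ℕ.≤ size U) (n≤|V| : n ℕ.≤ size V) (0<ε : Lo ε 0ℚ)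
    (l<2n[1-√ε] : ∀ q → SqrtLower ε q → toℚ (suc l) ≤ toℚ (2 ℕ.* n) * (1ℚ - q))
    (b>√ε : SqrtUpper ε b) (a+b<d : a + b < d)
    (dense : ∀ X Y → X ⊆ᵥ U → Y ⊆ᵥ V → RealTimesLe ε (size U) (size X) → RealTimesLe ε (size V) (size Y) →
             d - a ≤ density G X Y)
    (v : Fin N) (v∈V : lookup V v ≡ true) (deg-v : (d - a) * toℚ (size U) ≤ toℚ (degIn G U v))
    where

    open ShortPath ε n l 0<ε l<2n[1-√ε]

    c x : ℚ
    c = d - a
    x = c - b

    0<b : 0ℚ < b
    0<b = proj₁ b>√ε

    0≤x : 0ℚ ≤ x
    0≤x = ℚP.<⇒≤ (<-via-difference (solve 3 (λ d a b → ((d :- a) :- b) :- con 0ℚ := d :- (a :+ b)) refl d a b) (p<q⇒0<q-p a+b<d))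

    x≤c : x ≤ c
    x≤c = ≤-via-difference (solve 2 (λ c b → c :- (c :- b) := b) refl c b) (ℚP.<⇒≤ 0<b)

    -- The last vertex of a path lies in S, the next one is chosen in T.
    data Sides : VSet N → VSet N → Set where
      VU : Sides V U
      UV : Sides U V

    flip : ∀ {S T} → Sides S T → Sides T S
    flip VU = UV
    flip UV = VU

    n≤|S| : ∀ {S T} → Sides S T → n ℕ.≤ size S
    n≤|S| VU = n≤|V|
    n≤|S| UV = n≤|U|

    n≤|T| : ∀ {S T} → Sides S T → n ℕ.≤ size T
    n≤|T| sides = n≤|S| (flip sides)

    T⇒∉S : ∀ {S T} → Sides S T → ∀ y → lookup T y ≡ true → lookup S y ≡ false
    T⇒∉S VU y y∈U = U∩V≡∅ y y∈U
    T⇒∉S UV y y∈V = BoolP.¬-not λ y∈U → contradiction (trans (sym y∈V) (U∩V≡∅ y y∈U)) λ ()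

    edge-across : ∀ {S T} → Sides S T → ∀ {s t} → adj G s t ≡ true → lookup S s ≡ true → lookup T t ≡ true → EdgeUV G U V s t
    edge-across VU st s∈V t∈U = st , inj₂ (s∈V , t∈U)
    edge-across UV st s∈U t∈V = st , inj₁ (s∈U , t∈V)

    degree-sum-≥ : ∀ {S T} → Sides S T → ∀ (B R : VSet N) → B ⊆ᵥ T → R ⊆ᵥ S →
      RealTimesLe ε (size T) (size B) → RealTimesLe ε (size S) (size R) → 1 ℕ.≤ size B ℕ.* size R →
      c * toℚ (size B ℕ.* size R) ≤ toℚ (sumWhere (lookup B) (degIn G R))
    degree-sum-≥ VU B R B⊆U R⊆V B-large R-large 1≤|B||R| =
      subst (λ e → c * toℚ (size B ℕ.* size R) ≤ toℚ e) (edges≡sumWhere-degIn G B R)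
        (density-lower-bound⇒edges G B R (dense B R B⊆U R⊆V B-large R-large) 1≤|B||R|)
    degree-sum-≥ UV B R B⊆V R⊆U B-large R-large 1≤|B||R| =
      subst₂ (λ k e → c * toℚ k ≤ toℚ e) (ℕP.*-comm (size R) (size B)) (trans (edges-comm G R B) (edges≡sumWhere-degIn G B R))
        (density-lower-bound⇒edges G R B (dense R B R⊆U B⊆V R-large B-large) (subst (1 ℕ.≤_) (ℕP.*-comm (size B) (size R)) 1≤|B||R|))

    -- Otherwise the density of the pair (B, R) would be below c = d - a, which regularity forbids.
    low-degree-not-large : ∀ {S T} → Sides S T → ∀ (B R : VSet N) → B ⊆ᵥ T → R ⊆ᵥ S →
      RealTimesLe ε (size S) (size R) → 1 ℕ.≤ size R → ∀ {y₀} → lookup B y₀ ≡ true →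
      (∀ y → lookup B y ≡ true → toℚ (degIn G R y) < c * toℚ (size R)) → ¬ RealTimesLe ε (size T) (size B)
    low-degree-not-large sides B R B⊆T R⊆S R-large 1≤|R| y₀∈B low B-large = <⇒≱ sum< sum≥
      where
      sum≥ : c * toℚ (size B ℕ.* size R) ≤ toℚ (sumWhere (lookup B) (degIn G R))
      sum≥ = degree-sum-≥ sides B R B⊆T R⊆S B-large R-large (ℕP.*-mono-≤ (1≤count (lookup B) y₀∈B) 1≤|R|)
      sum< : toℚ (sumWhere (lookup B) (degIn G R)) < c * toℚ (size B ℕ.* size R)
      sum< = ℚP.<-≤-trans (sumWhere-< (lookup B) (degIn G R) (c * toℚ (size R)) low y₀∈B) (ℚP.≤-reflexive (begin
        toℚ (size B) * (c * toℚ (size R))    ≡⟨ solve 3 (λ β c ρ → β :* (c :* ρ) := c :* (β :* ρ)) refl (toℚ (size B)) c (toℚ (size R)) ⟩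
        c * (toℚ (size B) * toℚ (size R))    ≡⟨ cong (c *_) (toℚ-* (size B) (size R)) ⟨
        c * toℚ (size B ℕ.* size R)          ∎))
        where open ≡-Reasoning

    few-low-degree : ∀ {S T} → Sides S T → ∀ (B R : VSet N) → B ⊆ᵥ T → R ⊆ᵥ S →
      RealTimesLe ε (size S) (size R) → 1 ℕ.≤ size R →
      (∀ y → lookup B y ≡ true → toℚ (degIn G R y) < c * toℚ (size R)) →
      ∀ m → (∀ q → SqrtLower ε q → q * toℚ (size T) ≤ toℚ m) → toℚ (size B) ≤ b * toℚ m
    few-low-degree {S} {T} sides B R B⊆T R⊆S R-large 1≤|R| low m survivors = by-emptiness (1 ℕ.≤? size B)
      where
      0<|T| : 0ℚ < toℚ (size T)
      0<|T| = 0<toℚ (ℕP.≤-trans 1≤n (n≤|T| sides))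
      B-small : 1 ℕ.≤ size B → ¬ (∀ p → Lo ε p → p * toℚ (size T) ≤ toℚ (size B))
      B-small 1≤|B| = low-degree-not-large sides B R B⊆T R⊆S R-large 1≤|R| (proj₂ (1≤count⇒∃ (lookup B) 1≤|B|)) low
                      ∘ RealTimesLe⁺ ε (size T) (size B)
      by-emptiness : Dec (1 ℕ.≤ size B) → toℚ (size B) ≤ b * toℚ m
      by-emptiness (no |B|≱1) = ℚP.≤-trans (toℚ-mono-≤ {size B} {0} (ℕP.≤-pred (ℕP.≰⇒> |B|≱1)))
        (ℚP.≤-trans (ℚP.≤-reflexive toℚ-zero) (0≤p*q (ℚP.<⇒≤ 0<b) (0≤toℚ m)))
      by-emptiness (yes 1≤|B|) = begin
        toℚ (size B)               ≡⟨ |B|≡bq|T| ⟩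
        b * q * toℚ (size T)       ≡⟨ ℚP.*-assoc b q (toℚ (size T)) ⟩
        b * (q * toℚ (size T))     ≤⟨ ℚP.*-monoˡ-≤-nonNeg b {{ℚ.nonNegative (ℚP.<⇒≤ 0<b)}} (survivors q q<√ε) ⟩
        b * toℚ m                  ∎
        where
        open ℚP.≤-Reasoning
        factored : ∃ λ q → SqrtLower ε q × toℚ (size B) ≡ b * q * toℚ (size T)
        factored = below-ε⇒b*below-√ε ε b>√ε (0<toℚ 1≤|B|) 0<|T| (B-small 1≤|B|)
        q = proj₁ factored
        q<√ε = proj₁ (proj₂ factored)
        |B|≡bq|T| = proj₂ (proj₂ factored)

    endpoint : ∀ {j} → Vec (Fin N) (suc j) → Fin N
    endpoint {j} p = lookup p (fromℕ j)

    -- kS and kT bound how many path vertices lie in S and in T.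
    record Good (j : ℕ) (S T : VSet N) (kS kT : ℕ) (p : Vec (Fin N) (suc j)) : Set where
      field
        starts-at-v : Vec.head p ≡ v
        distinct    : Distinct p
        steps       : ∀ (i : Fin j) → EdgeUV G U V (lookup p (inject₁ i)) (lookup p (suc i))
        endpoint∈S  : lookup S (endpoint p) ≡ true
        S-used      : size S ℕ.≤ size (remove S p) ℕ.+ kS
        T-used      : size T ℕ.≤ size (remove T p) ℕ.+ kT
        typical     : j ℕ.< l → c * toℚ (size (remove T p)) ≤ toℚ (degIn G (remove T p) (endpoint p))

    record Level (j : ℕ) : Set where
      field
        S T          : VSet N
        kS kT        : ℕ
        sides        : Sides S T
        2kT≤j+1      : 2 ℕ.* kT ℕ.≤ suc j
        2kS≤j+2      : 2 ℕ.* kS ℕ.≤ suc (suc j)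
        paths        : List (Vec (Fin N) (suc j))
        paths-unique : Unique paths
        paths-good   : All (Good j S T kS kT) paths
        many-paths   : x ^ℚ j * toℚ (prodFl n j) ≤ toℚ (length paths)

    v∉U : lookup U v ≡ false
    v∉U = T⇒∉S UV v v∈V

    good₀ : Good 0 V U 1 0 (v ∷ [])
    good₀ = record
      { starts-at-v = refl
      ; distinct    = λ { zero zero _ → refl }
      ; steps       = λ ()
      ; endpoint∈S  = v∈V
      ; S-used      = ℕP.≤-trans (ℕP.≤-reflexive (size-cong V (remove V []) (λ y → sym (remove-[] V y))))
                        (ℕP.≤-trans (size-remove-∷ʳ V [] v) (ℕP.≤-reflexive (ℕP.+-comm 1 _)))
      ; T-used      = ℕP.≤-reflexive (trans (sym (size-cong (remove U (v ∷ [])) U U≗)) (sym (ℕP.+-identityʳ _)))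
      ; typical     = λ _ → subst₂ (λ s e → c * toℚ s ≤ toℚ e) (sym (size-cong (remove U (v ∷ [])) U U≗)) (sym (degIn-cong G (remove U (v ∷ [])) U v U≗)) deg-v
      }
      where
      U≗ : ∀ y → lookup (remove U (v ∷ [])) y ≡ lookup U y
      U≗ y = trans (remove-∷ʳ-∉ U [] v∉U y) (remove-[] U y)

    level₀ : Level 0
    level₀ = record
      { S = V ; T = U ; kS = 1 ; kT = 0 ; sides = VU
      ; 2kT≤j+1 = z≤n ; 2kS≤j+2 = ℕP.≤-refl
      ; paths = (v ∷ []) ∷ [] ; paths-unique = [] ∷ [] ; paths-good = good₀ ∷ []
      ; many-paths = ℚP.≤-reflexive (ℚP.*-identityˡ (toℚ 1))
      }

    Available : ∀ {j} → VSet N → Vec (Fin N) (suc j) → Fin N → Bool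
    Available T p y = lookup (remove T p) y ∧ adj G (endpoint p) y

    good-∷ʳ : ∀ {j S T kS kT} → Sides S T → ∀ p → Good j S T kS kT p → ∀ y → Available T p y ≡ true →
      (suc j ℕ.< l → c * toℚ (size (remove S p)) ≤ toℚ (degIn G (remove S p) y)) →
      Good (suc j) T S (suc kT) kS (p ∷ʳ y)
    good-∷ʳ {j} {S} {T} {kS} {kT} sides p good y y-available y-typical = record
      { starts-at-v = trans (head-∷ʳ p y) starts-at-v
      ; distinct    = distinct-∷ʳ p y distinct y∉p
      ; steps       = steps-∷ʳ (EdgeUV G U V) p y steps (edge-across sides (BoolP.∧-conicalʳ _ _ y-available) endpoint∈S y∈T)
      ; endpoint∈S  = subst (λ z → lookup T z ≡ true) (sym (lookup-∷ʳ-fromℕ p y)) y∈T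
      ; S-used      = ℕP.≤-trans T-used (ℕP.≤-trans (ℕP.+-monoˡ-≤ kT (size-remove-∷ʳ T p y))
                        (ℕP.≤-reflexive (sym (ℕP.+-suc (size (remove T (p ∷ʳ y))) kT))))
      ; T-used      = subst (λ s → size S ℕ.≤ s ℕ.+ kS) (sym S-unchanged) S-used
      ; typical     = λ j+1<l → subst₂ (λ s e → c * toℚ s ≤ toℚ e) (sym S-unchanged) (sym deg-unchanged) (y-typical j+1<l)
      }
      where
      open Good good
      y∈T∖p : (lookup T y ∧ not (y ∈ᵇ p)) ≡ true
      y∈T∖p = trans (sym (lookup-remove T p y)) (BoolP.∧-conicalˡ _ _ y-available)
      y∈T : lookup T y ≡ true
      y∈T = BoolP.∧-conicalˡ _ _ y∈T∖p
      y∉p : y ∈ᵇ p ≡ false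
      y∉p = BoolP.not-injective (BoolP.∧-conicalʳ _ _ y∈T∖p)
      S≗ : ∀ z → lookup (remove S (p ∷ʳ y)) z ≡ lookup (remove S p) z
      S≗ = remove-∷ʳ-∉ S p (T⇒∉S sides y y∈T)
      S-unchanged : size (remove S (p ∷ʳ y)) ≡ size (remove S p)
      S-unchanged = size-cong (remove S (p ∷ʳ y)) (remove S p) S≗
      deg-unchanged : degIn G (remove S (p ∷ʳ y)) (endpoint (p ∷ʳ y)) ≡ degIn G (remove S p) y
      deg-unchanged = trans (cong (degIn G (remove S (p ∷ʳ y))) (lookup-∷ʳ-fromℕ p y))
                            (degIn-cong G (remove S (p ∷ʳ y)) (remove S p) y S≗)

    n∸k≤m : ∀ {s m k} → n ℕ.≤ s → s ℕ.≤ m ℕ.+ k → n ℕ.∸ k ℕ.≤ m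
    n∸k≤m {s} {m} {k} n≤s s≤m+k = ℕP.≤-trans (ℕP.∸-monoˡ-≤ k (ℕP.≤-trans n≤s s≤m+k)) (ℕP.≤-reflexive (ℕP.m+n∸n≡m m k))

    module _ {j} (L : Level j) (j<l : j ℕ.< l) where
      open Level L

      Typical : Vec (Fin N) (suc j) → Fin N → Set
      Typical p y = c * toℚ (size (remove S p)) ≤ toℚ (degIn G (remove S p) y)

      typical? : ∀ p y → Dec (Typical p y)
      typical? p y = c * toℚ (size (remove S p)) ℚP.≤? toℚ (degIn G (remove S p) y)

      Atypical : Vec (Fin N) (suc j) → Fin N → Bool
      Atypical p y = Available T p y ∧ not (does (typical? p y))

      few-atypical : suc j ℕ.< l → ∀ p → Good j S T kS kT p → toℚ (count (Atypical p)) ≤ b * toℚ (size (remove T p))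
      few-atypical j+1<l p good = ℚP.≤-trans (toℚ-mono-≤ (count-mono atypical⊆Low))
        (few-low-degree sides Low R Low⊆T R⊆S (survivors-ε-large {size R} {kS} {size S} (n≤|S| sides) S-used 2kS≤l)
          (survivors-nonempty (n≤|S| sides) S-used 2kS≤l) Low-low (size (remove T p)) (survivors-large (n≤|T| sides) T-used 2kT≤l))
        where
        open Good good
        R = remove S p
        Low : VSet N
        Low = Vec.tabulate λ y → lookup T y ∧ not (does (typical? p y))
        lookup-Low : ∀ y → lookup Low y ≡ (lookup T y ∧ not (does (typical? p y)))
        lookup-Low = VecP.lookup∘tabulate (λ y → lookup T y ∧ not (does (typical? p y)))
        Low⊆T : Low ⊆ᵥ T
        Low⊆T y y∈Low = BoolP.∧-conicalˡ _ _ (trans (sym (lookup-Low y)) y∈Low)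
        R⊆S : R ⊆ᵥ S
        R⊆S y y∈R = BoolP.∧-conicalˡ _ _ (trans (sym (lookup-remove S p y)) y∈R)
        Low-low : ∀ y → lookup Low y ≡ true → toℚ (degIn G R y) < c * toℚ (size R)
        Low-low y y∈Low = ℚP.≰⇒> (¬does⇒¬ (typical? p y)
          (BoolP.not-injective (BoolP.∧-conicalʳ (lookup T y) _ (trans (sym (lookup-Low y)) y∈Low))))
        atypical⊆Low : ∀ y → Atypical p y ≡ true → lookup Low y ≡ true
        atypical⊆Low y y-atypical = trans (lookup-Low y) (cong₂ _∧_ y∈T (BoolP.∧-conicalʳ (Available T p y) _ y-atypical))
          where
          y∈T : lookup T y ≡ true
          y∈T = BoolP.∧-conicalˡ _ _ (trans (sym (lookup-remove T p y))
                  (BoolP.∧-conicalˡ _ _ (BoolP.∧-conicalˡ (Available T p y) _ y-atypical)))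
        2kS≤l : 2 ℕ.* kS ℕ.≤ l
        2kS≤l = ℕP.≤-trans 2kS≤j+2 j+1<l
        2kT≤l : 2 ℕ.* kT ℕ.≤ l
        2kT≤l = ℕP.≤-trans 2kT≤j+1 j<l

      -- kT ≤ ⌊(j+1)/2⌋ turns the x (n ∸ kT) extensions of each path into the factor n ∸ ⌊(j+1)/2⌋ of prodFl.
      extend : (next : Vec (Fin N) (suc j) → Fin N → Bool) →
        (∀ p y → next p y ≡ true → Available T p y ≡ true) →
        (∀ p y → next p y ≡ true → suc j ℕ.< l → Typical p y) →
        (∀ p → Good j S T kS kT p → x * toℚ (n ℕ.∸ kT) ≤ toℚ (count (next p))) →
        Level (suc j)
      extend next available typical many-next = record
        { S = T ; T = S ; kS = suc kT ; kT = kS ; sides = flip sides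
        ; 2kT≤j+1 = 2kS≤j+2
        ; 2kS≤j+2 = subst (ℕ._≤ suc (suc (suc j))) (sym (ℕP.*-suc 2 kT)) (s≤s (s≤s 2kT≤j+1))
        ; paths = extensions (witnesses ∘ next) paths
        ; paths-unique = extensions-unique (witnesses ∘ next) paths paths-unique (witnesses-unique ∘ next)
        ; paths-good = extensions-all (witnesses ∘ next) (Good (suc j) T S (suc kT) kS) paths λ {p} p∈ {y} y∈ →
            let next-y = ∈-witnesses⁻ (next p) y∈ in
            good-∷ʳ sides p (All.lookup paths-good p∈) y (available p y next-y) (typical p y next-y)
        ; many-paths = begin
            x * x ^ℚ j * toℚ (prodFl n j ℕ.* n∸⌊j+1/2⌋)       ≡⟨ cong (x * x ^ℚ j *_) (toℚ-* (prodFl n j) n∸⌊j+1/2⌋) ⟩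
            x * x ^ℚ j * (toℚ (prodFl n j) * toℚ n∸⌊j+1/2⌋)   ≡⟨ solve 4 (λ x xʲ P M → x :* xʲ :* (P :* M) := xʲ :* P :* (x :* M))
                                                                 refl x (x ^ℚ j) (toℚ (prodFl n j)) (toℚ n∸⌊j+1/2⌋) ⟩
            x ^ℚ j * toℚ (prodFl n j) * r                     ≤⟨ ℚP.*-monoʳ-≤-nonNeg r {{ℚ.nonNegative 0≤r}} many-paths ⟩
            toℚ (length paths) * r                            ≤⟨ length-extensions (witnesses ∘ next) paths r r≤next ⟩
            toℚ (length (extensions (witnesses ∘ next) paths)) ∎
        }
        where
        open ℚP.≤-Reasoning
        n∸⌊j+1/2⌋ : ℕ
        n∸⌊j+1/2⌋ = n ℕ.∸ (suc j DM./ 2)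
        r : ℚ
        r = x * toℚ n∸⌊j+1/2⌋
        0≤r : 0ℚ ≤ r
        0≤r = 0≤p*q 0≤x (0≤toℚ n∸⌊j+1/2⌋)
        kT≤⌊j+1/2⌋ : kT ℕ.≤ suc j DM./ 2
        kT≤⌊j+1/2⌋ = subst (ℕ._≤ suc j DM./ 2) (DM.m*n/n≡m kT 2) (DM./-monoˡ-≤ 2 (subst (ℕ._≤ suc j) (ℕP.*-comm 2 kT) 2kT≤j+1))
        r≤next : ∀ {p} → p ∈ paths → r ≤ toℚ (length (witnesses (next p)))
        r≤next {p} p∈ = ℚP.≤-trans (ℚP.*-monoˡ-≤-nonNeg x {{ℚ.nonNegative 0≤x}} (toℚ-mono-≤ (ℕP.∸-monoʳ-≤ n kT≤⌊j+1/2⌋)))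
          (ℚP.≤-trans (many-next p (All.lookup paths-good p∈)) (ℚP.≤-reflexive (cong toℚ (sym (length-witnesses (next p))))))

      extend-last : ¬ (suc j ℕ.< l) → Level (suc j)
      extend-last j+1≮l = extend (Available T) (λ _ _ available → available) (λ _ _ _ j+1<l → contradiction j+1<l j+1≮l) many-available
        where
        many-available : ∀ p → Good j S T kS kT p → x * toℚ (n ℕ.∸ kT) ≤ toℚ (count (Available T p))
        many-available p good = begin
          x * toℚ (n ℕ.∸ kT)               ≤⟨ ℚP.*-monoˡ-≤-nonNeg x {{ℚ.nonNegative 0≤x}} (toℚ-mono-≤ (n∸k≤m (n≤|T| sides) T-used)) ⟩
          x * toℚ (size (remove T p))      ≤⟨ ℚP.*-monoʳ-≤-nonNeg (toℚ (size (remove T p))) {{ℚ.nonNegative (0≤toℚ _)}} x≤c ⟩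
          c * toℚ (size (remove T p))      ≤⟨ typical j<l ⟩
          toℚ (count (Available T p))      ∎
          where
          open ℚP.≤-Reasoning
          open Good good

      extend-inner : suc j ℕ.< l → Level (suc j)
      extend-inner j+1<l = extend next (λ _ _ e → BoolP.∧-conicalˡ _ _ e)
        (λ p y e _ → does⇒ (typical? p y) (BoolP.∧-conicalʳ (Available T p y) _ e)) many-next
        where
        next : Vec (Fin N) (suc j) → Fin N → Bool
        next p y = Available T p y ∧ does (typical? p y)
        many-next : ∀ p → Good j S T kS kT p → x * toℚ (n ℕ.∸ kT) ≤ toℚ (count (next p))
        many-next p good = begin
          x * toℚ (n ℕ.∸ kT)                                  ≤⟨ ℚP.*-monoˡ-≤-nonNeg x {{ℚ.nonNegative 0≤x}} (toℚ-mono-≤ (n∸k≤m (n≤|T| sides) T-used)) ⟩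
          x * toℚ m                                           ≡⟨ ℚP.*-distribʳ-+ (toℚ m) c (- b) ⟩
          c * toℚ m + - b * toℚ m                             ≡⟨ cong (c * toℚ m +_) (ℚP.neg-distribˡ-* b (toℚ m)) ⟨
          c * toℚ m - b * toℚ m                               ≤⟨ ℚP.+-mono-≤ (typical j<l) (ℚP.neg-antimono-≤ (few-atypical j+1<l p good)) ⟩
          toℚ (count (Available T p)) - toℚ (count (Atypical p))
            ≡⟨ cong (_- toℚ (count (Atypical p))) (trans (cong toℚ (count-split (Available T p) (does ∘ typical? p)))
                                                        (toℚ-+ (count (next p)) (count (Atypical p)))) ⟩
          toℚ (count (next p)) + toℚ (count (Atypical p)) - toℚ (count (Atypical p))
            ≡⟨ solve 2 (λ a b → a :+ b :- b := a) refl (toℚ (count (next p))) (toℚ (count (Atypical p))) ⟩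
          toℚ (count (next p))                                ∎
          where
          open ℚP.≤-Reasoning
          open Good good
          m = size (remove T p)

    level : ∀ j → j ℕ.≤ l → Level j
    level zero    _   = level₀
    level (suc j) j<l with suc j ℕ.<? l
    ... | yes j+1<l = extend-inner (level j (ℕP.<⇒≤ j<l)) j<l j+1<l
    ... | no  j+1≮l = extend-last (level j (ℕP.<⇒≤ j<l)) j<l j+1≮l

    many-paths-from-v : AtLeastPaths G U V v l (x ^ℚ l * ℕ→ℚ (prodFl n l))
    many-paths-from-v = length paths , count-bound , List.lookup paths , Unique⇒lookup-injective paths-unique , is-path
      where
      open Level (level l ℕP.≤-refl)
      count-bound : x ^ℚ l * ℕ→ℚ (prodFl n l) ≤ ℕ→ℚ (length paths)
      count-bound = subst₂ (λ P K → x ^ℚ l * P ≤ K) (toℚ≡ℕ→ℚ (prodFl n l)) (toℚ≡ℕ→ℚ (length paths)) many-paths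
      is-path : ∀ i → IsPathFrom G U V v l (List.lookup paths i)
      is-path i = starts-at-v , distinct , steps
        where open Good (All.lookup paths-good (∈-lookup i))

open import Defs
open import Data.Nat using (ℕ; suc; _≤_; _*_)
open import Data.Rational using (ℚ; 0ℚ; 1ℚ; _+_; _-_; _<_) renaming (_*_ to _*ℚ_; _≤_ to _≤ℚ_)
open import Data.Fin using (Fin)
open import Data.Vec using (lookup)
open import Data.Bool using (true)
open import Data.Product using (∃; _×_)
open import Relation.Binary.PropositionalEquality using (_≡_; refl; sym; subst₂)
open import Data.Rational.Properties using (<⇒≤)
open PathsInRegularPairs using (toℚ; toℚ≡ℕ→ℚ; Lo<Up; regular⇒density-≥; module GreedyPaths)

lemma2p8 : ∀ {N : ℕ} (G : Graph N) (ε : ℝ) (U V : VSet N) (n : ℕ) (d : ℚ) →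
    Disjoint U V →
    Regular G ε U V →
    n ≤ size U → n ≤ size V →
    density G U V ≡ d →
    Lo ε 0ℚ →
    (∀ q → Up ε q → 1ℚ ≤ℚ ℕ→ℚ n *ℚ (q *ℚ q)) →
    (∃ λ a → ∃ λ b → Up ε a × SqrtUpper ε b × a + b < d) →
    ∀ (v : Fin N) → lookup V v ≡ true →
    (∀ q → Up ε q → (d - q) *ℚ ℕ→ℚ (size U) ≤ℚ ℕ→ℚ (degIn G U v)) →
    ∀ (l : ℕ) → 1 ≤ l →
    (∀ q → SqrtLower ε q → ℕ→ℚ (suc l) ≤ℚ ℕ→ℚ (2 * n) *ℚ (1ℚ - q)) →
    ∀ (a b : ℚ) → Up ε a → SqrtUpper ε b → a + b < d →
    AtLeastPaths G U V v l (((d - a) - b) ^ℚ l *ℚ ℕ→ℚ (prodFl n l))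
lemma2p8 G ε U V n _ U∩V≡∅ regular n≤|U| n≤|V| refl 0<ε _ _ v v∈V deg-v l _ l<2n[1-√ε] a b a>ε b>√ε a+b<d =
  GreedyPaths.many-paths-from-v G ε U V n l U∩V≡∅ n≤|U| n≤|V| 0<ε l<2n[1-√ε]′ b>√ε a+b<d
    (regular⇒density-≥ G ε U V regular (<⇒≤ (Lo<Up ε 0<ε a>ε)) a>ε) v v∈V deg-v′
  where
  l<2n[1-√ε]′ : ∀ q → SqrtLower ε q → toℚ (suc l) ≤ℚ toℚ (2 * n) *ℚ (1ℚ - q)
  l<2n[1-√ε]′ q q<√ε = subst₂ (λ s m → s ≤ℚ m *ℚ (1ℚ - q)) (sym (toℚ≡ℕ→ℚ (suc l))) (sym (toℚ≡ℕ→ℚ (2 * n))) (l<2n[1-√ε] q q<√ε)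
  deg-v′ : (density G U V - a) *ℚ toℚ (size U) ≤ℚ toℚ (degIn G U v)
  deg-v′ = subst₂ (λ s e → (density G U V - a) *ℚ s ≤ℚ e) (sym (toℚ≡ℕ→ℚ (size U))) (sym (toℚ≡ℕ→ℚ (degIn G U v))) (deg-v a a>ε)
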